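{- Let $Y_0 = \lambda f.\,\omega_f\,\omega_f$ with $\omega_f = \lambda x.\,f(xx)$ (Curry's fixed point combinator), let $\delta = \lambda a b.\,b(ab)$, and for $n \geq 0$ let $Y_n = Y_0\,\delta\,\delta \cdots \delta$ ($n$ copies of $\delta$, application associating to the left). Then the sequence $Y_0, Y_1, Y_2, \ldots$ contains no duplicates: for all $n \neq m$, $Y_n$ and $Y_m$ are not $\beta$-convertible.
   Context: We work in the untyped $\lambda$-calculus with $\beta$-reduction; terms are considered modulo renaming of bound variables. $\beta$-convertibility is the equivalence closure of the compatible closure of $(\lambda x.M)N \to M[x:=N]$. -}

module Defs where

open import Data.Nat using (ℕ; zero; suc; _<ᵇ_)
open import Data.Bool using (if_then_else_)
open import Data.Nat using (_≡ᵇ_; _∸_)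

-- Untyped λ-terms in de Bruijn notation (terms are thus identified modulo
-- renaming of bound variables, i.e. α-equivalence is syntactic equality).
data Term : Set where
  var : ℕ → Term
  lam : Term → Term
  app : Term → Term → Term

shift : ℕ → Term → Term
shift c (var k) = if k <ᵇ c then var k else var (suc k)
shift c (lam t) = lam (shift (suc c) t)
shift c (app t u) = app (shift c t) (shift c u)

-- subst j s t : substitute s for variable j in t, and decrement the free
-- variables above j (removing the binder); used for β: (λ.M) N → subst 0 N M
subst : ℕ → Term → Term → Term
subst j s (var k) =
  if k ≡ᵇ j then s else (if j <ᵇ k then var (k ∸ 1) else var k)
subst j s (lam t) = lam (subst (suc j) (shift 0 s) t)
subst j s (app t u) = app (subst j s t) (subst j s u)

data _⟶β_ : Term → Term → Set where
  β    : ∀ {M N} → app (lam M) N ⟶β subst 0 N M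
  ξlam : ∀ {M M'} → M ⟶β M' → lam M ⟶β lam M'
  ξappˡ : ∀ {M M' N} → M ⟶β M' → app M N ⟶β app M' N
  ξappʳ : ∀ {M N N'} → N ⟶β N' → app M N ⟶β app M N'

data _=β_ : Term → Term → Set where
  step   : ∀ {M N} → M ⟶β N → M =β N
  refl=  : ∀ {M} → M =β M
  sym=   : ∀ {M N} → M =β N → N =β M
  trans= : ∀ {M N P} → M =β N → N =β P → M =β P

-- ω_f = λx. f (x x), under binder f (f = var 1 inside λx)
-- Y₀ = λf. ω_f ω_f
Y₀ : Term
Y₀ = lam (app (lam (app (var 1) (app (var 0) (var 0))))
              (lam (app (var 1) (app (var 0) (var 0)))))

δ : Term
δ = lam (lam (app (var 0) (app (var 1) (var 0))))

Y : ℕ → Term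
Y zero = Y₀
Y (suc n) = app (Y n) δ

module Submission where

-- By the Church–Rosser theorem two convertible terms have a
-- common reduct, so it suffices to find, for every n, a set of terms
-- YForm n that contains Y n, is closed under β-reduction, and such that the
-- sets for different n are disjoint.  YForm n is given by an explicit grammar
-- describing every reduct of Y n.  For instance Y₀ δ reduces along
--   Y₀ δ → ω_δ ω_δ → δ (ω_δ ω_δ) → λb. b (ω_δ ω_δ b) → ⋯,
-- and (λb. b v) δ → δ v[b:=δ] feeds the next δ into such a body.  The
-- index n can be read off any term of YForm n (the grammar's clauses have
-- pairwise distinct head shapes), which gives disjointness.

open import Defs
open import Data.Nat using (ℕ; zero; suc; _<ᵇ_; _≡ᵇ_; _∸_; _≤_; _<_; z≤n; s≤s; z<s; s<s)
open import Data.Nat.Properties using (suc-injective; <-≤-trans; <⇒≤; m<1+n⇒m<n∨m≡n)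
open import Data.Bool using (true; false; if_then_else_)
open import Data.Product using (Σ; _×_; _,_)
open import Data.Sum using (inj₁; inj₂)
open import Data.Empty using (⊥-elim)
open import Function using (id)
open import Relation.Binary.Construct.Closure.ReflexiveTransitive
  using (Star; ε; _◅_; _◅◅_; gmap; _⋆)
open import Relation.Binary.PropositionalEquality
  using (_≡_; refl; sym; trans; cong; cong₂) renaming (subst to transport)
open import Relation.Nullary using (¬_)

-- 1. Renaming and substitution

Ren : Set
Ren = ℕ → ℕ

Sub : Set
Sub = ℕ → Term

ext : Ren → Ren
ext ρ zero    = zero
ext ρ (suc k) = suc (ρ k)

rename : Ren → Term → Term
rename ρ (var k)   = var (ρ k)
rename ρ (lam t)   = lam (rename (ext ρ) t)
rename ρ (app t u) = app (rename ρ t) (rename ρ u)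

exts : Sub → Sub
exts σ zero    = var zero
exts σ (suc k) = rename suc (σ k)

sub : Sub → Term → Term
sub σ (var k)   = σ k
sub σ (lam t)   = lam (sub (exts σ) t)
sub σ (app t u) = app (sub σ t) (sub σ u)

-- u • σ sends 0 to u and k+1 to σ k; single substitution t[u] is sub (u • var) t.
_•_ : Term → Sub → Sub
(u • σ) zero    = u
(u • σ) (suc k) = σ k

-- Renaming and substitution only depend on the pointwise values of their
-- argument (we have no function extensionality).
ext-cong : ∀ {ρ ρ' : Ren} → (∀ k → ρ k ≡ ρ' k) → ∀ k → ext ρ k ≡ ext ρ' k
ext-cong h zero    = refl
ext-cong h (suc k) = cong suc (h k)

rename-cong : ∀ {ρ ρ' : Ren} → (∀ k → ρ k ≡ ρ' k) → ∀ t → rename ρ t ≡ rename ρ' t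
rename-cong h (var k)   = cong var (h k)
rename-cong h (lam t)   = cong lam (rename-cong (ext-cong h) t)
rename-cong h (app t u) = cong₂ app (rename-cong h t) (rename-cong h u)

exts-cong : ∀ {σ σ' : Sub} → (∀ k → σ k ≡ σ' k) → ∀ k → exts σ k ≡ exts σ' k
exts-cong h zero    = refl
exts-cong h (suc k) = cong (rename suc) (h k)

sub-cong : ∀ {σ σ' : Sub} → (∀ k → σ k ≡ σ' k) → ∀ t → sub σ t ≡ sub σ' t
sub-cong h (var k)   = h k
sub-cong h (lam t)   = cong lam (sub-cong (exts-cong h) t)
sub-cong h (app t u) = cong₂ app (sub-cong h t) (sub-cong h u)

rename-rename : ∀ (ρ ρ' : Ren) t → rename ρ' (rename ρ t) ≡ rename (λ k → ρ' (ρ k)) t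
rename-rename ρ ρ' (var k)   = refl
rename-rename ρ ρ' (lam t)   =
  cong lam (trans (rename-rename (ext ρ) (ext ρ') t) (rename-cong pt t))
  where
  pt : ∀ k → ext ρ' (ext ρ k) ≡ ext (λ k → ρ' (ρ k)) k
  pt zero    = refl
  pt (suc k) = refl
rename-rename ρ ρ' (app t u) = cong₂ app (rename-rename ρ ρ' t) (rename-rename ρ ρ' u)

sub-rename : ∀ (σ : Sub) (ρ : Ren) t → sub σ (rename ρ t) ≡ sub (λ k → σ (ρ k)) t
sub-rename σ ρ (var k)   = refl
sub-rename σ ρ (lam t)   =
  cong lam (trans (sub-rename (exts σ) (ext ρ) t) (sub-cong pt t))
  where
  pt : ∀ k → exts σ (ext ρ k) ≡ exts (λ k → σ (ρ k)) k
  pt zero    = refl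
  pt (suc k) = refl
sub-rename σ ρ (app t u) = cong₂ app (sub-rename σ ρ t) (sub-rename σ ρ u)

rename-sub : ∀ (ρ : Ren) (σ : Sub) t → rename ρ (sub σ t) ≡ sub (λ k → rename ρ (σ k)) t
rename-sub ρ σ (var k)   = refl
rename-sub ρ σ (lam t)   =
  cong lam (trans (rename-sub (ext ρ) (exts σ) t) (sub-cong pt t))
  where
  pt : ∀ k → rename (ext ρ) (exts σ k) ≡ exts (λ k → rename ρ (σ k)) k
  pt zero    = refl
  pt (suc k) = trans (rename-rename suc (ext ρ) (σ k)) (sym (rename-rename ρ suc (σ k)))
rename-sub ρ σ (app t u) = cong₂ app (rename-sub ρ σ t) (rename-sub ρ σ u)

sub-sub : ∀ (σ τ : Sub) t → sub τ (sub σ t) ≡ sub (λ k → sub τ (σ k)) t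
sub-sub σ τ (var k)   = refl
sub-sub σ τ (lam t)   =
  cong lam (trans (sub-sub (exts σ) (exts τ) t) (sub-cong pt t))
  where
  pt : ∀ k → sub (exts τ) (exts σ k) ≡ exts (λ k → sub τ (σ k)) k
  pt zero    = refl
  pt (suc k) = trans (sub-rename (exts τ) suc (σ k)) (sym (rename-sub suc τ (σ k)))
sub-sub σ τ (app t u) = cong₂ app (sub-sub σ τ t) (sub-sub σ τ u)

sub-var : ∀ t → sub var t ≡ t
sub-var (var k)   = refl
sub-var (lam t)   = cong lam (trans (sub-cong pt t) (sub-var t))
  where
  pt : ∀ k → exts var k ≡ var k
  pt zero    = refl
  pt (suc k) = refl
sub-var (app t u) = cong₂ app (sub-var t) (sub-var u)

-- Renaming and substitution commute with single substitution: the
-- substitution lemma needed for parallel reduction to be stable.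
rename-[] : ∀ (ρ : Ren) u t →
  rename ρ (sub (u • var) t) ≡ sub (rename ρ u • var) (rename (ext ρ) t)
rename-[] ρ u t =
  trans (rename-sub ρ (u • var) t)
        (trans (sub-cong pt t) (sym (sub-rename (rename ρ u • var) (ext ρ) t)))
  where
  pt : ∀ k → rename ρ ((u • var) k) ≡ (rename ρ u • var) (ext ρ k)
  pt zero    = refl
  pt (suc k) = refl

sub-[] : ∀ (σ : Sub) u t →
  sub σ (sub (u • var) t) ≡ sub (sub σ u • var) (sub (exts σ) t)
sub-[] σ u t =
  trans (sub-sub (u • var) σ t)
        (trans (sub-cong pt t) (sym (sub-sub (exts σ) (sub σ u • var) t)))
  where
  pt : ∀ k → sub σ ((u • var) k) ≡ sub (sub σ u • var) (exts σ k)
  pt zero    = refl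
  pt (suc k) = sym (trans (sub-rename (sub σ u • var) suc (σ k)) (sub-var (σ k)))

shift-ren : ℕ → Ren
shift-ren c k = if k <ᵇ c then k else suc k

subst-sub : ℕ → Term → Sub
subst-sub j s k = if k ≡ᵇ j then s else (if j <ᵇ k then var (k ∸ 1) else var k)

shift≡rename : ∀ c t → shift c t ≡ rename (shift-ren c) t
shift≡rename c (var k) with k <ᵇ c
... | true  = refl
... | false = refl
shift≡rename c (lam t)   =
  cong lam (trans (shift≡rename (suc c) t) (rename-cong (λ k → sym (ext-shift k)) t))
  where
  ext-shift : ∀ k → ext (shift-ren c) k ≡ shift-ren (suc c) k
  ext-shift zero = refl
  ext-shift (suc k) with k <ᵇ c
  ... | true  = refl
  ... | false = refl
shift≡rename c (app t u) = cong₂ app (shift≡rename c t) (shift≡rename c u)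

shift0≡rename-suc : ∀ t → shift 0 t ≡ rename suc t
shift0≡rename-suc t = trans (shift≡rename 0 t) (rename-cong (λ k → refl) t)

subst≡sub : ∀ j s t → subst j s t ≡ sub (subst-sub j s) t
subst≡sub j s (var k)   = refl
subst≡sub j s (lam t)   =
  cong lam (trans (subst≡sub (suc j) (shift 0 s) t) (sub-cong (λ k → sym (exts-subst k)) t))
  where
  exts-subst : ∀ k → exts (subst-sub j s) k ≡ subst-sub (suc j) (shift 0 s) k
  exts-subst zero = refl
  exts-subst (suc zero) with zero ≡ᵇ j
  ... | true  = sym (shift0≡rename-suc s)
  ... | false = refl
  exts-subst (suc (suc k)) with suc k ≡ᵇ j
  ... | true  = sym (shift0≡rename-suc s)
  ... | false with j <ᵇ suc k
  ...   | true  = refl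
  ...   | false = refl
subst≡sub j s (app t u) = cong₂ app (subst≡sub j s t) (subst≡sub j s u)

subst0≡[] : ∀ u t → subst 0 u t ≡ sub (u • var) t
subst0≡[] u t = trans (subst≡sub 0 u t) (sub-cong pt t)
  where
  pt : ∀ k → subst-sub 0 u k ≡ (u • var) k
  pt zero    = refl
  pt (suc k) = refl

-- 2. Church–Rosser

infix 4 _⇒_ _↠_

_↠_ : Term → Term → Set
_↠_ = Star _⟶β_

data _⇒_ : Term → Term → Set where
  pvar  : ∀ {k} → var k ⇒ var k
  plam  : ∀ {t t'} → t ⇒ t' → lam t ⇒ lam t'
  papp  : ∀ {t t' u u'} → t ⇒ t' → u ⇒ u' → app t u ⇒ app t' u'
  pbeta : ∀ {t t' u u'} → t ⇒ t' → u ⇒ u' → app (lam t) u ⇒ sub (u' • var) t'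

⇒-refl : ∀ t → t ⇒ t
⇒-refl (var k)   = pvar
⇒-refl (lam t)   = plam (⇒-refl t)
⇒-refl (app t u) = papp (⇒-refl t) (⇒-refl u)

⇒-rename : ∀ (ρ : Ren) {t t'} → t ⇒ t' → rename ρ t ⇒ rename ρ t'
⇒-rename ρ pvar       = pvar
⇒-rename ρ (plam p)   = plam (⇒-rename (ext ρ) p)
⇒-rename ρ (papp p q) = papp (⇒-rename ρ p) (⇒-rename ρ q)
⇒-rename ρ (pbeta {t' = t'} {u' = u'} p q) =
  transport (_ ⇒_) (sym (rename-[] ρ u' t')) (pbeta (⇒-rename (ext ρ) p) (⇒-rename ρ q))

⇒-exts : ∀ {σ σ' : Sub} → (∀ k → σ k ⇒ σ' k) → ∀ k → exts σ k ⇒ exts σ' k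
⇒-exts h zero    = pvar
⇒-exts h (suc k) = ⇒-rename suc (h k)

⇒-sub : ∀ {σ σ' : Sub} → (∀ k → σ k ⇒ σ' k) → ∀ {t t'} → t ⇒ t' → sub σ t ⇒ sub σ' t'
⇒-sub h pvar       = h _
⇒-sub h (plam p)   = plam (⇒-sub (⇒-exts h) p)
⇒-sub h (papp p q) = papp (⇒-sub h p) (⇒-sub h q)
⇒-sub {σ' = σ'} h (pbeta {t' = t'} {u' = u'} p q) =
  transport (_ ⇒_) (sym (sub-[] σ' u' t')) (pbeta (⇒-sub (⇒-exts h) p) (⇒-sub h q))

develop : Term → Term
develop (var k)         = var k
develop (lam t)         = lam (develop t)
develop (app (lam t) u) = sub (develop u • var) (develop t)
develop (app t u)       = app (develop t) (develop u)

⇒-develop : ∀ {t t'} → t ⇒ t' → t' ⇒ develop t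
⇒-develop pvar                 = pvar
⇒-develop (plam p)             = plam (⇒-develop p)
⇒-develop (papp (plam p) q)    = pbeta (⇒-develop p) (⇒-develop q)
⇒-develop (papp {var _} p q)   = papp (⇒-develop p) (⇒-develop q)
⇒-develop (papp {app _ _} p q) = papp (⇒-develop p) (⇒-develop q)
⇒-develop (pbeta {u = u} {u' = u'} p q) = ⇒-sub develop-arg (⇒-develop p)
  where
  develop-arg : ∀ k → (u' • var) k ⇒ (develop u • var) k
  develop-arg zero    = ⇒-develop q
  develop-arg (suc k) = pvar

strip : ∀ {t t₁ t₂} → t ⇒ t₁ → Star _⇒_ t t₂ → Σ Term λ w → Star _⇒_ t₁ w × t₂ ⇒ w
strip p ε = _ , ε , p
strip p (q ◅ qs) with strip (⇒-develop q) qs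
... | w , t₁⇒*w , t₂⇒w = w , ⇒-develop p ◅ t₁⇒*w , t₂⇒w

⇒*-confluent : ∀ {t t₁ t₂} → Star _⇒_ t t₁ → Star _⇒_ t t₂ →
  Σ Term λ w → Star _⇒_ t₁ w × Star _⇒_ t₂ w
⇒*-confluent ε q = _ , q , ε
⇒*-confluent (p ◅ ps) q with strip p q
... | w₁ , a , b with ⇒*-confluent ps a
... | w , c , d = w , c , b ◅ d

-- ⟶β ⊆ ⇒ ⊆ ↠, so ↠ is the reflexive–transitive closure of ⇒.
⟶β⇒⇒ : ∀ {M N} → M ⟶β N → M ⇒ N
⟶β⇒⇒ (β {M} {N}) =
  transport (app (lam M) N ⇒_) (sym (subst0≡[] N M)) (pbeta (⇒-refl M) (⇒-refl N))
⟶β⇒⇒ (ξlam s)  = plam (⟶β⇒⇒ s)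
⟶β⇒⇒ (ξappˡ s) = papp (⟶β⇒⇒ s) (⇒-refl _)
⟶β⇒⇒ (ξappʳ s) = papp (⇒-refl _) (⟶β⇒⇒ s)

⇒⇒↠ : ∀ {M N} → M ⇒ N → M ↠ N
⇒⇒↠ pvar       = ε
⇒⇒↠ (plam p)   = gmap lam ξlam (⇒⇒↠ p)
⇒⇒↠ (papp {t' = t'} {u = u} p q) =
  gmap (λ M → app M u) ξappˡ (⇒⇒↠ p) ◅◅ gmap (app t') ξappʳ (⇒⇒↠ q)
⇒⇒↠ (pbeta {t' = t'} {u = u} {u' = u'} p q) =
  gmap (λ M → app M u) ξappˡ (gmap lam ξlam (⇒⇒↠ p))
    ◅◅ gmap (app (lam t')) ξappʳ (⇒⇒↠ q)
    ◅◅ transport (app (lam t') u' ↠_) (subst0≡[] u' t') (β ◅ ε)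

↠-confluent : ∀ {M N₁ N₂} → M ↠ N₁ → M ↠ N₂ → Σ Term λ P → N₁ ↠ P × N₂ ↠ P
↠-confluent p q with ⇒*-confluent (gmap id ⟶β⇒⇒ p) (gmap id ⟶β⇒⇒ q)
... | P , a , b = P , (⇒⇒↠ ⋆) a , (⇒⇒↠ ⋆) b

church-rosser : ∀ {M N} → M =β N → Σ Term λ P → M ↠ P × N ↠ P
church-rosser (step s) = _ , s ◅ ε , ε
church-rosser refl=    = _ , ε , ε
church-rosser (sym= h) with church-rosser h
... | P , a , b = P , b , a
church-rosser (trans= h₁ h₂) with church-rosser h₁ | church-rosser h₂
... | P₁ , a , b | P₂ , c , d with ↠-confluent b c
... | P , e , f = P , a ◅◅ e , d ◅◅ f

-- 3. Scoped terms and normal forms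

data Scoped (d : ℕ) : Term → Set where
  svar : ∀ {k} → k < d → Scoped d (var k)
  slam : ∀ {t} → Scoped (suc d) t → Scoped d (lam t)
  sapp : ∀ {t u} → Scoped d t → Scoped d u → Scoped d (app t u)

Scoped-weaken : ∀ {d d' t} → d ≤ d' → Scoped d t → Scoped d' t
Scoped-weaken d≤d' (svar k<d) = svar (<-≤-trans k<d d≤d')
Scoped-weaken d≤d' (slam s)   = slam (Scoped-weaken (s≤s d≤d') s)
Scoped-weaken d≤d' (sapp s r) = sapp (Scoped-weaken d≤d' s) (Scoped-weaken d≤d' r)

<ᵇ-true : ∀ {m n} → m < n → (m <ᵇ n) ≡ true
<ᵇ-true {zero}  (s≤s _) = refl
<ᵇ-true {suc m} (s≤s p) = <ᵇ-true p

<ᵇ-false : ∀ {m n} → n ≤ m → (m <ᵇ n) ≡ false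
<ᵇ-false z≤n     = refl
<ᵇ-false (s≤s p) = <ᵇ-false p

≡ᵇ-false : ∀ {m n} → m < n → (m ≡ᵇ n) ≡ false
≡ᵇ-false {zero}  {suc n} _       = refl
≡ᵇ-false {suc m} {suc n} (s≤s p) = ≡ᵇ-false p

≡ᵇ-refl : ∀ n → (n ≡ᵇ n) ≡ true
≡ᵇ-refl zero    = refl
≡ᵇ-refl (suc n) = ≡ᵇ-refl n

shift-scoped : ∀ {d c t} → Scoped d t → d ≤ c → shift c t ≡ t
shift-scoped (svar k<d) d≤c rewrite <ᵇ-true (<-≤-trans k<d d≤c) = refl
shift-scoped (slam s)   d≤c = cong lam (shift-scoped s (s≤s d≤c))
shift-scoped (sapp s r) d≤c = cong₂ app (shift-scoped s d≤c) (shift-scoped r d≤c)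

subst-scoped : ∀ {d j t} → Scoped d t → d ≤ j → ∀ s → subst j s t ≡ t
subst-scoped (svar k<d) d≤j s
  rewrite ≡ᵇ-false (<-≤-trans k<d d≤j) | <ᵇ-false (<⇒≤ (<-≤-trans k<d d≤j)) = refl
subst-scoped (slam t) d≤j s = cong lam (subst-scoped t (s≤s d≤j) (shift 0 s))
subst-scoped (sapp t u) d≤j s = cong₂ app (subst-scoped t d≤j s) (subst-scoped u d≤j s)

-- Substituting variable j for itself is the identity on terms scoped below j+1
-- (in general it would also decrement the variables above j).
subst-self : ∀ {j t} → Scoped (suc j) t → subst j (var j) t ≡ t
subst-self {j} (svar {k} k<1+j) with m<1+n⇒m<n∨m≡n k<1+j
... | inj₁ k<j rewrite ≡ᵇ-false k<j | <ᵇ-false (<⇒≤ k<j) = refl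
... | inj₂ refl rewrite ≡ᵇ-refl j = refl
subst-self (slam t)   = cong lam (subst-self t)
subst-self (sapp t u) = cong₂ app (subst-self t) (subst-self u)

mutual
  data Normal : Term → Set where
    ne   : ∀ {t} → Neutral t → Normal t
    nlam : ∀ {t} → Normal t → Normal (lam t)

  data Neutral : Term → Set where
    nvar : ∀ {k} → Neutral (var k)
    napp : ∀ {t u} → Neutral t → Normal u → Neutral (app t u)

mutual
  normal-irreducible : ∀ {t u} → Normal t → ¬ (t ⟶β u)
  normal-irreducible (ne n)   s         = neutral-irreducible n s
  normal-irreducible (nlam n) (ξlam s)  = normal-irreducible n s

  neutral-irreducible : ∀ {t u} → Neutral t → ¬ (t ⟶β u)
  neutral-irreducible (napp n m) (ξappˡ s) = neutral-irreducible n s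
  neutral-irreducible (napp n m) (ξappʳ s) = normal-irreducible m s

-- 4. The shapes of the reducts of Y n

-- ω_f = λx. f (x x), where f is the variable bound just outside; Y₀ = λf. ω_f ω_f.
ωf : Term
ωf = lam (app (var 1) (app (var 0) (var 0)))

ωδ : Term
ωδ = lam (app δ (app (var 0) (var 0)))

-- ω'_δ = λx b. b (x x b), the unique reduct of ω_δ.
ωδ' : Term
ωδ' = lam (lam (app (var 0) (app (app (var 1) (var 1)) (var 0))))

-- The reducts of the body of Y₀: f (f ⋯ (f (ω_f ω_f))), in scope of f.
data Y₀Body : Term → Set where
  ωf-ωf : Y₀Body (app ωf ωf)
  f-app : ∀ {t} → Y₀Body t → Y₀Body (app (var 0) t)

data Ωδ : Term → Set where
  is-ωδ  : Ωδ ωδ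
  is-ωδ' : Ωδ ωδ'

mutual
  data YForm : ℕ → Term → Set where
    y₀      : ∀ {t} → Y₀Body t → YForm 0 (lam t)
    δ-arg   : ∀ {n X} → YForm n X → YForm (suc n) (app X δ)
    ωδ-pair : ∀ {w w'} → Ωδ w → Ωδ w' → YForm 1 (app w w')
    δ-head  : ∀ {n X} → YForm (suc n) X → YForm (suc n) (app δ X)
    b-abs   : ∀ {n v} → YBody n v → YForm (suc n) (lam (app (var 0) v))

  -- YBody n v: v = b (b ⋯ (b (X b))) with X of shape n+1, in scope of b;
  -- λb. b v is what δ X reduces to.
  data YBody : ℕ → Term → Set where
    X-b : ∀ {n X} → YForm (suc n) X → YBody n (app X (var 0))
    b-v : ∀ {n v} → YBody n v → YBody n (app (var 0) v)

Y-YForm : ∀ n → YForm n (Y n)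
Y-YForm zero    = y₀ ωf-ωf
Y-YForm (suc n) = δ-arg (Y-YForm n)

δ-closed : Scoped 0 δ
δ-closed = slam (slam (sapp (svar z<s) (sapp (svar (s<s z<s)) (svar z<s))))

xx-scoped : Scoped 1 (app (var 0) (var 0))
xx-scoped = sapp (svar z<s) (svar z<s)

Y₀Body-scoped : ∀ {t} → Y₀Body t → Scoped 1 t
Y₀Body-scoped ωf-ωf    = sapp ωf-scoped ωf-scoped
  where
  ωf-scoped : Scoped 1 ωf
  ωf-scoped = slam (sapp (svar (s<s z<s)) (Scoped-weaken (s≤s z≤n) xx-scoped))
Y₀Body-scoped (f-app b) = sapp (svar z<s) (Y₀Body-scoped b)

Ωδ-closed : ∀ {w} → Ωδ w → Scoped 0 w
Ωδ-closed is-ωδ  = slam (sapp (Scoped-weaken z≤n δ-closed) xx-scoped)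
Ωδ-closed is-ωδ' =
  slam (slam (sapp (svar z<s) (sapp (sapp (svar (s<s z<s)) (svar (s<s z<s))) (svar z<s))))

mutual
  YForm-closed : ∀ {n M} → YForm n M → Scoped 0 M
  YForm-closed (y₀ b)          = slam (Y₀Body-scoped b)
  YForm-closed (δ-arg h)       = sapp (YForm-closed h) δ-closed
  YForm-closed (ωδ-pair w w')  = sapp (Ωδ-closed w) (Ωδ-closed w')
  YForm-closed (δ-head h)      = sapp δ-closed (YForm-closed h)
  YForm-closed (b-abs v)       = slam (sapp (svar z<s) (YBody-scoped v))

  YBody-scoped : ∀ {n v} → YBody n v → Scoped 1 v
  YBody-scoped (X-b h) = sapp (Scoped-weaken z≤n (YForm-closed h)) (svar z<s)
  YBody-scoped (b-v v) = sapp (svar z<s) (YBody-scoped v)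

δ-normal : Normal δ
δ-normal = nlam (nlam (ne (napp nvar (ne (napp nvar (ne nvar))))))

xx-normal : Normal (app (var 0) (var 0))
xx-normal = ne (napp nvar (ne nvar))

ωf-normal : Normal ωf
ωf-normal = nlam (ne (napp nvar xx-normal))

ωδ'-normal : Normal ωδ'
ωδ'-normal = nlam (nlam (ne (napp nvar (ne (napp (napp nvar (ne nvar)) (ne nvar))))))

Y₀Body-step : ∀ {t u} → Y₀Body t → t ⟶β u → Y₀Body u
Y₀Body-step ωf-ωf     β         = f-app ωf-ωf
Y₀Body-step ωf-ωf     (ξappˡ s) = ⊥-elim (normal-irreducible ωf-normal s)
Y₀Body-step ωf-ωf     (ξappʳ s) = ⊥-elim (normal-irreducible ωf-normal s)
Y₀Body-step (f-app b) (ξappʳ s) = f-app (Y₀Body-step b s)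

Ωδ-step : ∀ {w w'} → Ωδ w → w ⟶β w' → Ωδ w'
Ωδ-step is-ωδ  (ξlam β)         = is-ωδ'
Ωδ-step is-ωδ  (ξlam (ξappˡ s)) = ⊥-elim (normal-irreducible δ-normal s)
Ωδ-step is-ωδ  (ξlam (ξappʳ s)) = ⊥-elim (normal-irreducible xx-normal s)
Ωδ-step is-ωδ' s                = ⊥-elim (normal-irreducible ωδ'-normal s)

-- Contracting Y₀ δ and (λb. b v) δ: substituting δ into a body.
Y₀Body-δ : ∀ {t} → Y₀Body t → YForm 1 (subst 0 δ t)
Y₀Body-δ ωf-ωf     = ωδ-pair is-ωδ is-ωδ
Y₀Body-δ (f-app b) = δ-head (Y₀Body-δ b)

YBody-δ : ∀ {n v} → YBody n v → YForm (suc (suc n)) (subst 0 δ v)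
YBody-δ (X-b h) =
  transport (λ X → YForm _ (app X δ)) (sym (subst-scoped (YForm-closed h) z≤n δ)) (δ-arg h)
YBody-δ (b-v v) = δ-head (YBody-δ v)

mutual
  YForm-step : ∀ {n M N} → YForm n M → M ⟶β N → YForm n N
  YForm-step (y₀ b)                (ξlam s)  = y₀ (Y₀Body-step b s)
  YForm-step (δ-arg (y₀ b))        β         = Y₀Body-δ b
  YForm-step (δ-arg (b-abs v))     β         = δ-head (YBody-δ v)
  YForm-step (δ-arg h)             (ξappˡ s) = δ-arg (YForm-step h s)
  YForm-step (δ-arg h)             (ξappʳ s) = ⊥-elim (normal-irreducible δ-normal s)
  YForm-step (ωδ-pair is-ωδ w')    β         = δ-head (ωδ-pair w' w')
  YForm-step (ωδ-pair is-ωδ' is-ωδ)  β       = b-abs (X-b (ωδ-pair is-ωδ is-ωδ))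
  YForm-step (ωδ-pair is-ωδ' is-ωδ') β       = b-abs (X-b (ωδ-pair is-ωδ' is-ωδ'))
  YForm-step (ωδ-pair w w')        (ξappˡ s) = ωδ-pair (Ωδ-step w s) w'
  YForm-step (ωδ-pair w w')        (ξappʳ s) = ωδ-pair w (Ωδ-step w' s)
  YForm-step (δ-head h)            β         =
    transport (λ X → YForm _ (lam (app (var 0) (app X (var 0)))))
              (sym (shift-scoped (YForm-closed h) z≤n)) (b-abs (X-b h))
  YForm-step (δ-head h)            (ξappˡ s) = ⊥-elim (normal-irreducible δ-normal s)
  YForm-step (δ-head h)            (ξappʳ s) = δ-head (YForm-step h s)
  YForm-step (b-abs v)             (ξlam (ξappʳ s)) = b-abs (YBody-step v s)

  YBody-step : ∀ {n v v'} → YBody n v → v ⟶β v' → YBody n v'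
  YBody-step (X-b (b-abs v)) β =
    transport (λ u → YBody _ (app (var 0) u)) (sym (subst-self (YBody-scoped v))) (b-v v)
  YBody-step (X-b h) (ξappˡ s) = X-b (YForm-step h s)
  YBody-step (b-v v) (ξappʳ s) = b-v (YBody-step v s)

YForm-↠ : ∀ {n M N} → YForm n M → M ↠ N → YForm n N
YForm-↠ h ε        = h
YForm-↠ h (s ◅ ss) = YForm-↠ (YForm-step h s) ss

¬YForm-δ : ∀ {n} → ¬ YForm n δ
¬YForm-δ (y₀ ())

¬Ωδ-δ : ¬ Ωδ δ
¬Ωδ-δ ()

Y₀Body-YBody-disjoint : ∀ {n t} → Y₀Body t → ¬ YBody n t
Y₀Body-YBody-disjoint (f-app b) (b-v v)     = Y₀Body-YBody-disjoint b v
Y₀Body-YBody-disjoint (f-app ()) (X-b _)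

mutual
  YForm-index-unique : ∀ {n m M} → YForm n M → YForm m M → n ≡ m
  YForm-index-unique (y₀ b)          (y₀ b')         = refl
  YForm-index-unique (y₀ (f-app b))  (b-abs v)       = ⊥-elim (Y₀Body-YBody-disjoint b v)
  YForm-index-unique (b-abs v)       (y₀ (f-app b))  = ⊥-elim (Y₀Body-YBody-disjoint b v)
  YForm-index-unique (δ-arg h)       (δ-arg h')      = cong suc (YForm-index-unique h h')
  YForm-index-unique (δ-arg h)       (ωδ-pair w w')  = ⊥-elim (¬Ωδ-δ w')
  YForm-index-unique (ωδ-pair w w')  (δ-arg h)       = ⊥-elim (¬Ωδ-δ w')
  YForm-index-unique (δ-arg h)       (δ-head h')     = ⊥-elim (¬YForm-δ h)
  YForm-index-unique (δ-head h')     (δ-arg h)       = ⊥-elim (¬YForm-δ h)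
  YForm-index-unique (ωδ-pair w w')  (ωδ-pair x x')  = refl
  YForm-index-unique (ωδ-pair w w')  (δ-head h)      = ⊥-elim (¬Ωδ-δ w)
  YForm-index-unique (δ-head h)      (ωδ-pair w w')  = ⊥-elim (¬Ωδ-δ w)
  YForm-index-unique (δ-head h)      (δ-head h')     = YForm-index-unique h h'
  YForm-index-unique (b-abs v)       (b-abs v')      = cong suc (YBody-index-unique v v')

  YBody-index-unique : ∀ {n m v} → YBody n v → YBody m v → n ≡ m
  YBody-index-unique (X-b h) (X-b h') = suc-injective (YForm-index-unique h h')
  YBody-index-unique (X-b ()) (b-v v)
  YBody-index-unique (b-v v) (X-b ())
  YBody-index-unique (b-v v) (b-v v') = YBody-index-unique v v'

-- A common reduct P of Y n and Y m would have both shapes n and m.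
theorem8 : (n m : ℕ) → ¬ (n ≡ m) → ¬ (Y n =β Y m)
theorem8 n m n≢m Yn=Ym with church-rosser Yn=Ym
... | P , Yn↠P , Ym↠P =
  n≢m (YForm-index-unique (YForm-↠ (Y-YForm n) Yn↠P) (YForm-↠ (Y-YForm m) Ym↠P))
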